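{- Let $p\in\mathbb{N}$ and $r$ an integer with $0\le r<p$, and let $a_n=pn-r$ for $n\ge1$. Let $k\in\mathbb{N}$ be odd with $\gcd(k,p)=1$. Then the sequence $(\Gamma(k,a_n))_{n=1}^\infty$ is (eventually) periodic with minimal period $T_k((a_n)_{n=1}^\infty)=k$, and within each period the number of $0$'s is one more than the number of $1$'s.
   Context: For relatively prime positive integers $a',b'$, exactly one of the two equations $a'x+b'y=\frac{(a'-1)(b'-1)}{2}$ and $1+a'x+b'y=\frac{(a'-1)(b'-1)}{2}$ has a solution $(x,y)$ in nonnegative integers (and it is unique). For $a,b\in\mathbb{N}$ let $g=\gcd(a,b)$, $a'=a/g$, $b'=b/g$; define $\Gamma(a,b)=0$ if $a'x+b'y=\frac{(a'-1)(b'-1)}{2}$ has a nonnegative integral solution, and $\Gamma(a,b)=1$ if $1+a'x+b'y=\frac{(a'-1)(b'-1)}{2}$ has a nonnegative integral solution. For $k\in\mathbb{N}$ and a sequence of positive integers $(a_n)_{n=1}^\infty$, $T_k((a_n)_{n=1}^\infty)$ denotes the eventual (minimal) period of the sequence $(\Gamma(k,a_n))_{n=1}^\infty$, when it exists. -}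

module Defs where

open import Data.Nat using (ℕ; zero; suc; _+_; _*_; _∸_; _≤_; _<_; _≡ᵇ_; s≤s; z≤n)
open import Data.Nat.Properties using (_≟_; m≤m*n; m≤n+m; m≤m+n; ≤-trans; ≤-reflexive)
open import Data.Nat.DivMod using (_/_)
open import Data.Nat.GCD using (gcd)
open import Data.Fin using (Fin; toℕ; fromℕ<)
open import Data.Fin.Properties using (any?; toℕ-fromℕ<)
open import Data.Product using (Σ; ∃; _,_; _×_; proj₁; proj₂)
open import Data.Bool using (if_then_else_)
open import Relation.Nullary using (Dec; yes; no)
open import Relation.Nullary.Decidable using (map′)
open import Relation.Binary.PropositionalEquality using (_≡_; refl; sym; trans; cong; subst)

Solvable : ℕ → ℕ → ℕ → ℕ → Set
Solvable d a b c = ∃ λ x → ∃ λ y → d + a * x + b * y ≡ c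

-- decidability (helper fact, via the bound x, y ≤ c after normalisation)

private
  BSolv : ℕ → ℕ → ℕ → ℕ → Set
  BSolv d a b c = ∃ λ (x : Fin (suc c)) → ∃ λ (y : Fin (suc c)) → d + a * toℕ x + b * toℕ y ≡ c

  bsolv? : ∀ d a b c → Dec (BSolv d a b c)
  bsolv? d a b c = any? λ x → any? λ y → (d + a * toℕ x + b * toℕ y) ≟ c

  x≤c : ∀ d a b c x y → d + suc a * x + b * y ≡ c → x ≤ c
  x≤c d a b c x y e =
    ≤-trans (≤-trans (m≤m+n x (a * x))
      (≤-trans (m≤n+m (suc a * x) d) (m≤m+n (d + suc a * x) (b * y)))) (≤-reflexive e)

  y≤c : ∀ d a b c x y → d + a * x + suc b * y ≡ c → y ≤ c
  y≤c d a b c x y e =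
    ≤-trans (≤-trans (m≤m+n y (b * y)) (m≤n+m (suc b * y) (d + a * x))) (≤-reflexive e)

  normX : ∀ d a b c x y → d + a * x + b * y ≡ c →
          Σ ℕ λ x' → x' < suc c × (d + a * x' + b * y ≡ c)
  normX d zero b c x y e = zero , s≤s z≤n , e
  normX d (suc a) b c x y e = x , s≤s (x≤c d a b c x y e) , e

  normY : ∀ d a b c x y → d + a * x + b * y ≡ c →
          Σ ℕ λ y' → y' < suc c × (d + a * x + b * y' ≡ c)
  normY d a zero c x y e = zero , s≤s z≤n , e
  normY d a (suc b) c x y e = y , s≤s (y≤c d a b c x y e) , e


  toB : ∀ {d a b c} → Solvable d a b c → BSolv d a b c
  toB {d} {a} {b} {c} (x , y , e) with normX d a b c x y e
  ... | x' , x'< , e' with normY d a b c x' y e'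
  ... | y' , y'< , e'' =
    fromℕ< x'< , fromℕ< y'< ,
    subst (λ t → d + a * t + b * toℕ (fromℕ< y'<) ≡ c) (sym (toℕ-fromℕ< x'<))
      (subst (λ t → d + a * x' + b * t ≡ c) (sym (toℕ-fromℕ< y'<)) e'')

  fromB : ∀ {d a b c} → BSolv d a b c → Solvable d a b c
  fromB (x , y , e) = toℕ x , toℕ y , e

solvable? : ∀ d a b c → Dec (Solvable d a b c)
solvable? d a b c = map′ (fromB {d} {a} {b} {c}) (toB {d} {a} {b} {c}) (bsolv? d a b c)

-- division by g, with the (irrelevant) convention x / 0 = 0
_div_ : ℕ → ℕ → ℕ
a div zero = zero
a div suc g = a / suc g

-- Γ a b = 0 if  a'x + b'y = (a'-1)(b'-1)/2  is solvable,
--       = 1 if  1 + a'x + b'y = (a'-1)(b'-1)/2  is solvable,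
--       = 2 otherwise (never happens for a, b ≥ 1; junk value)
Γ : ℕ → ℕ → ℕ
Γ a b with solvable? 0 a' b' c | solvable? 1 a' b' c
  where
    g  = gcd a b
    a' = a div g
    b' = b div g
    c  = ((a' ∸ 1) * (b' ∸ 1)) / 2
... | yes _ | _     = 0
... | no _  | yes _ = 1
... | no _  | no _  = 2

EventuallyPeriodicWith : (ℕ → ℕ) → ℕ → Set
EventuallyPeriodicWith s T = ∃ λ N → ∀ n → N ≤ n → s (n + T) ≡ s n

IsEventualMinimalPeriod : (ℕ → ℕ) → ℕ → Set
IsEventualMinimalPeriod s T =
  0 < T × EventuallyPeriodicWith s T ×
  (∀ T' → 0 < T' → EventuallyPeriodicWith s T' → T ≤ T')

countIn : (ℕ → ℕ) → ℕ → ℕ → ℕ → ℕ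
countIn s v n zero = zero
countIn s v n (suc len) = (if s n ≡ᵇ v then 1 else 0) + countIn s v (suc n) len

-- The arithmetic progression a_n = p n - r (n ≥ 1), and the sequence
-- (Γ(k, a_n))_{n ≥ 1}, re-indexed from 0:  ΓSeq k p r m = Γ(k, a_{m+1}).

aSeq : ℕ → ℕ → ℕ → ℕ
aSeq p r n = p * n ∸ r

ΓSeq : ℕ → ℕ → ℕ → ℕ → ℕ
ΓSeq k p r m = Γ k (aSeq p r (suc m))

-- Write k = g a' and b = g b' with g = gcd k b and a' = 2h + 1. As h + 1 inverts 2 modulo a',
-- the residue u < a' with b' u ≡ h + 1 (mod a') decides Γ: Γ(k, b) = 0 iff u > h. If k ∤ b and
-- k ∣ b + b*, then b* has the same reduced modulus a' and residue a' − u, so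
-- Γ(k, b) + Γ(k, b*) = 1, while Γ(k, b) = 0 when k ∣ b; with b* = (k − 1) b this makes Γ(k, ·)
-- k-periodic. Along a_n = p n − r with p prime to k, one term per period is divisible by k and
-- the other k − 1 pair up into complementary values, so a period has one more zero than ones.
-- Counting the zeros and ones of k T consecutive terms in two ways then shows that every
-- eventual period T is a multiple of k.

module Submission where

open import Defs
open import Data.Nat using (ℕ; suc; _<_; _≤_; _+_)
open import Data.Nat.Divisibility using (_∣_)
open import Data.Nat.GCD using (gcd)
open import Data.Product using (∃; _×_)
open import Relation.Nullary using (¬_)
open import Relation.Binary.PropositionalEquality using (_≡_)

open import Data.Bool using (if_then_else_)
open import Data.Empty using (⊥-elim)
open import Data.Nat using (zero; _*_; _∸_; _≡ᵇ_; z≤n; s≤s; NonZero; ≢-nonZero; ≢-nonZero⁻¹; >-nonZero; >-nonZero⁻¹)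
open import Data.Nat.Properties
open import Data.Nat.DivMod using (_/_; _%_; m≡m%n+[m/n]*n; m%n<n; m*n/n≡m; m/n*n≡m; n/n≡1)
open import Data.Nat.Divisibility using (divides; ∣-refl; ∣m∣n⇒∣m+n; ∣m+n∣m⇒∣n; m∣m*n; ∣⇒≤; ∣-trans; ∣-antisym; ∣m⇒∣m*n; *-monoˡ-∣; 1∣_; _∣0; *-cancelʳ-∣; _∣?_; n∣m*n)
open import Data.Nat.GCD using (gcd[m,n]∣m; gcd[m,n]∣n; gcd[m,n]≢0; gcd-greatest; module Bézout)
open import Data.Nat.Coprimality using (Coprime; coprime-Bézout; coprime-divisor; coprime-/gcd; gcd≡1⇒coprime)
open import Data.Nat.Tactic.RingSolver using (solve-∀)
open import Data.Product using (_,_)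
open import Data.Sum using (_⊎_; inj₁; inj₂; [_,_])
open import Function using (_∘_; _⇔_; mk⇔; Equivalence)
open import Relation.Nullary using (Dec; yes; no)
open import Relation.Binary.PropositionalEquality using (refl; sym; trans; cong; cong₂; subst; subst₂; _≢_; module ≡-Reasoning)
open Bézout using (+-; -+)

odd⇒suc[h+h] : ∀ {n} → ¬ 2 ∣ n → ∃ λ h → n ≡ suc (h + h)
odd⇒suc[h+h] {zero} 2∤0 = ⊥-elim (2∤0 (divides 0 refl))
odd⇒suc[h+h] {suc zero} _ = 0 , refl
odd⇒suc[h+h] {suc (suc n)} 2∤n+2 with odd⇒suc[h+h] (2∤n+2 ∘ ∣m∣n⇒∣m+n ∣-refl)
... | h , refl = suc h , cong (suc ∘ suc) (sym (+-suc h h))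

odd⇒nonZero : ∀ {n} → ¬ 2 ∣ n → NonZero n
odd⇒nonZero {zero} 2∤0 = ⊥-elim (2∤0 (2 ∣0))
odd⇒nonZero {suc n} _ = _

-- Linear congruences

cancel-multiples : ∀ {a c X s t} → c < a → X + a * s ≡ c + a * t → ∃ λ m → X ≡ c + a * m
cancel-multiples {a} {c} {X} {s} {t} c<a eq with s ≤? t
... | yes s≤t with m , refl ← m≤n⇒∃[o]m+o≡n s≤t =
  m , +-cancelʳ-≡ (a * s) X (c + a * m) (trans eq (shuffle a c s m))
  where
    shuffle : ∀ a c s m → c + a * (s + m) ≡ c + a * m + a * s
    shuffle = solve-∀
... | no s≰t with z , refl ← m≤n⇒∃[o]m+o≡n (≰⇒> s≰t) =
  ⊥-elim (<⇒≱ c<a (≤-trans (m≤n+m a X) (≤-trans (m≤m+n (X + a) (a * z)) (≤-reflexive X+a+az≡c))))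
  where
    shuffle : ∀ a X t z → X + a * (suc t + z) ≡ X + a + a * z + a * t
    shuffle = solve-∀
    X+a+az≡c : X + a + a * z ≡ c
    X+a+az≡c = +-cancelʳ-≡ (a * t) _ c (trans (sym (shuffle a X t z)) eq)

coprime⇒∃[n]∣b*n+e : ∀ {a b} .{{_ : NonZero a}} → Coprime a b → ∀ e → ∃ λ n → a ∣ b * n + e
coprime⇒∃[n]∣b*n+e {a@(suc a')} {b} a⊥b e with coprime-Bézout a⊥b
... | +- x y 1+yb≡xa = y * e , divides (x * e) (begin
  b * (y * e) + e  ≡⟨ shuffle b y e ⟩
  (1 + y * b) * e  ≡⟨ cong (_* e) 1+yb≡xa ⟩
  x * a * e        ≡⟨ *-assoc x a e ⟩
  x * (a * e)      ≡⟨ cong (x *_) (*-comm a e) ⟩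
  x * (e * a)      ≡⟨ *-assoc x e a ⟨
  x * e * a        ∎)
  where
    open ≡-Reasoning
    shuffle : ∀ b y e → b * (y * e) + e ≡ (1 + y * b) * e
    shuffle = solve-∀
... | -+ x y 1+xa≡yb = y * (a' * e) , divides (e + x * (a' * e)) (begin
  b * (y * (a' * e)) + e  ≡⟨ cong (_+ e) (shuffle₁ b y (a' * e)) ⟩
  y * b * (a' * e) + e    ≡⟨ cong (λ m → m * (a' * e) + e) 1+xa≡yb ⟨
  (1 + x * a) * (a' * e) + e  ≡⟨ shuffle₂ x a' e ⟩
  (e + x * (a' * e)) * a  ∎)
  where
    open ≡-Reasoning
    shuffle₁ : ∀ b y m → b * (y * m) ≡ y * b * m
    shuffle₁ = solve-∀
    shuffle₂ : ∀ x a' e → (1 + x * suc a') * (a' * e) + e ≡ (e + x * (a' * e)) * suc a'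
    shuffle₂ = solve-∀

SolvesCongruence : ℕ → ℕ → ℕ → ℕ → Set
SolvesCongruence a b c u = ∃ λ x → b * u ≡ c + a * x

congruence-solvable : ∀ {a b c} → c < a → Coprime a b → ∃ λ u → u < a × SolvesCongruence a b c u
congruence-solvable {a@(suc a')} {b} {c} c<a a⊥b with n , divides q bn+a'c≡qa ← coprime⇒∃[n]∣b*n+e a⊥b (a' * c) =
  n % a , m%n<n n a , cancel-multiples c<a (begin
    b * (n % a) + a * (b * (n / a) + c)  ≡⟨ shuffle₁ b (n % a) (n / a) a' c ⟩
    b * (n % a + n / a * a) + a' * c + c ≡⟨ cong (λ m → b * m + a' * c + c) (m≡m%n+[m/n]*n n a) ⟨
    b * n + a' * c + c                   ≡⟨ cong (_+ c) bn+a'c≡qa ⟩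
    q * a + c                            ≡⟨ shuffle₂ q a c ⟩
    c + a * q                            ∎)
  where
    open ≡-Reasoning
    shuffle₁ : ∀ b r w a' c → b * r + suc a' * (b * w + c) ≡ b * (r + w * suc a') + a' * c + c
    shuffle₁ = solve-∀
    shuffle₂ : ∀ q a c → q * a + c ≡ c + a * q
    shuffle₂ = solve-∀

congruence-complement : ∀ {a b b' c u u'} → c < a → a ∣ b + b' → u + u' ≡ a →
  SolvesCongruence a b c u → SolvesCongruence a b' c u'
congruence-complement {a} {b} {b'} {c} {u} {u'} c<a (divides j b+b'≡ja) u+u'≡a (x , bu≡c+ax) =
  cancel-multiples c<a (begin
    b' * u' + a * b              ≡⟨ cong (λ m → b' * u' + m * b) u+u'≡a ⟨
    b' * u' + (u + u') * b       ≡⟨ shuffle₁ b b' u u' ⟩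
    (b + b') * u' + b * u        ≡⟨ cong₂ (λ m n → m * u' + n) b+b'≡ja bu≡c+ax ⟩
    j * a * u' + (c + a * x)     ≡⟨ shuffle₂ j a u' c x ⟩
    c + a * (j * u' + x)         ∎)
  where
    open ≡-Reasoning
    shuffle₁ : ∀ b b' u u' → b' * u' + (u + u') * b ≡ (b + b') * u' + b * u
    shuffle₁ = solve-∀
    shuffle₂ : ∀ j a u' c x → j * a * u' + (c + a * x) ≡ c + a * (j * u' + x)
    shuffle₂ = solve-∀

-- The equations a x + b y = h β and 1 + a x + b y = h β for a = 2h + 1, b = β + 1

coprime⇒a*suc[x]+b*suc[y]≢a*b : ∀ {a b x y} .{{_ : NonZero a}} → Coprime a b →
  a * suc x + b * suc y ≢ a * b
coprime⇒a*suc[x]+b*suc[y]≢a*b {a@(suc _)} {b} {x} {y} a⊥b eq =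
  n≮0 (+-cancelʳ-≤ (b * suc y) (a * suc x) 0 (begin
    a * suc x + b * suc y ≡⟨ eq ⟩
    a * b                 ≡⟨ *-comm a b ⟩
    b * a                 ≤⟨ *-monoʳ-≤ b (∣⇒≤ (coprime-divisor a⊥b a∣b*suc[y])) ⟩
    b * suc y             ∎))
  where
    open ≤-Reasoning
    a∣b*suc[y] : a ∣ b * suc y
    a∣b*suc[y] = ∣m+n∣m⇒∣n (subst (a ∣_) (sym eq) (m∣m*n b)) (m∣m*n (suc x))

congruence-quotient< : ∀ {a b c u x} .{{_ : NonZero b}} → u < a → b * u ≡ c + a * x → x < b
congruence-quotient< {a} {b} {c} {u} {x} u<a bu≡c+ax = *-cancelˡ-< a x b (begin-strict
  a * x      ≤⟨ m≤n+m (a * x) c ⟩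
  c + a * x  ≡⟨ bu≡c+ax ⟨
  b * u      <⟨ *-monoʳ-< b u<a ⟩
  b * a      ≡⟨ *-comm b a ⟩
  a * b      ∎)
  where open ≤-Reasoning

-- Here b u ≡ h + 1 ≡ 2⁻¹ (mod a), and the side of h on which u lies decides which equation is solvable.
solvable₀-of-large-residue : ∀ {h β u} → u < suc (h + h) → suc h ≤ u →
  SolvesCongruence (suc (h + h)) (suc β) (suc h) u → Solvable 0 (suc (h + h)) (suc β) (h * β)
solvable₀-of-large-residue {h} {β} {u} u<a h<u (x , bu≡h+1+ax)
  with X , refl ← m≤n⇒∃[o]m+o≡n (≤-pred (congruence-quotient< {suc (h + h)} {suc β} {suc h} u<a bu≡h+1+ax))
     | v , refl ← m≤n⇒∃[o]m+o≡n h<u =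
  X , v , +-cancelʳ-≡ (suc β * u) _ _ (begin
    0 + a * X + suc β * v + suc β * u       ≡⟨ cong (0 + a * X + suc β * v +_) bu≡h+1+ax ⟩
    0 + a * X + suc β * v + suc (h + a * x) ≡⟨ shuffle h x X v ⟩
    h * β + suc β * u                       ∎)
  where
    a = suc (h + h)
    open ≡-Reasoning
    shuffle : ∀ h x X v → 0 + suc (h + h) * X + suc (x + X) * v + suc (h + suc (h + h) * x)
                        ≡ h * (x + X) + suc (x + X) * (suc h + v)
    shuffle = solve-∀

solvable₁-of-small-residue : ∀ {h β u} → u ≤ h →
  SolvesCongruence (suc (h + h)) (suc β) (suc h) u → Solvable 1 (suc (h + h)) (suc β) (h * β)
solvable₁-of-small-residue {β = β} {u} u≤h (x , bu≡h+1+ax) with w , refl ← m≤n⇒∃[o]m+o≡n u≤h =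
  x , w , +-cancelʳ-≡ (suc β * u) _ _ (begin
    1 + a * x + suc β * w + suc β * u ≡⟨ shuffle u w β x ⟩
    (u + w) * β + suc (u + w + a * x) ≡⟨ cong ((u + w) * β +_) bu≡h+1+ax ⟨
    (u + w) * β + suc β * u           ∎)
  where
    a = suc (u + w + (u + w))
    open ≡-Reasoning
    shuffle : ∀ u w β x → 1 + suc (u + w + (u + w)) * x + suc β * w + suc β * u
                        ≡ (u + w) * β + suc (u + w + suc (u + w + (u + w)) * x)
    shuffle = solve-∀

¬solvable₀×solvable₁ : ∀ {h β} → Coprime (suc (h + h)) (suc β) →
  Solvable 0 (suc (h + h)) (suc β) (h * β) → ¬ Solvable 1 (suc (h + h)) (suc β) (h * β)
¬solvable₀×solvable₁ {h} {β} a⊥b (x₀ , y₀ , eq₀) (x₁ , y₁ , eq₁) =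
  coprime⇒a*suc[x]+b*suc[y]≢a*b a⊥b (+-cancelʳ-≡ 1 _ _ (begin
    a * suc (x₀ + x₁) + b * suc (y₀ + y₁) + 1                  ≡⟨ shuffle₁ h β x₀ y₀ x₁ y₁ ⟩
    (0 + a * x₀ + b * y₀) + (1 + a * x₁ + b * y₁) + a + b      ≡⟨ cong (λ m → m + a + b) (cong₂ _+_ eq₀ eq₁) ⟩
    h * β + h * β + a + b                                      ≡⟨ shuffle₂ h β ⟩
    a * b + 1                                                  ∎))
  where
    a = suc (h + h)
    b = suc β
    open ≡-Reasoning
    shuffle₁ : ∀ h β x₀ y₀ x₁ y₁ → suc (h + h) * suc (x₀ + x₁) + suc β * suc (y₀ + y₁) + 1
      ≡ (0 + suc (h + h) * x₀ + suc β * y₀) + (1 + suc (h + h) * x₁ + suc β * y₁) + suc (h + h) + suc β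
    shuffle₁ = solve-∀
    shuffle₂ : ∀ h β → h * β + h * β + suc (h + h) + suc β ≡ suc (h + h) * suc β + 1
    shuffle₂ = solve-∀

+-≡⇒≤-complement : ∀ {x y m n} → x + y ≡ m + n → m ≤ x → y ≤ n
+-≡⇒≤-complement {x} {y} {m} {n} eq m≤x =
  +-cancelˡ-≤ m y n (≤-trans (+-monoˡ-≤ y m≤x) (≤-reflexive eq))

positive-residue : ∀ {a b c u} → SolvesCongruence a b (suc c) u → 0 < u
positive-residue {b = b} {u = zero} (x , b*0≡c+1+ax) with () ← trans (sym (*-zeroʳ b)) b*0≡c+1+ax
positive-residue {u = suc u} _ = s≤s z≤n

-- If b' ≡ −b (mod a) the residue u becomes a − u, which lies on the other side of h.
complementary-residues : ∀ {h β β' u u'} → u < suc (h + h) → u + u' ≡ suc (h + h) →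
  SolvesCongruence (suc (h + h)) (suc β) (suc h) u → SolvesCongruence (suc (h + h)) (suc β') (suc h) u' →
  Solvable 0 (suc (h + h)) (suc β) (h * β) × Solvable 1 (suc (h + h)) (suc β') (h * β') ⊎
  Solvable 1 (suc (h + h)) (suc β) (h * β) × Solvable 0 (suc (h + h)) (suc β') (h * β')
complementary-residues {h} {β} {u = u} {u'} u<a u+u'≡a bu≡h+1 b'u'≡h+1 with suc h ≤? u
... | yes h<u = inj₁ ( solvable₀-of-large-residue u<a h<u bu≡h+1
                     , solvable₁-of-small-residue (+-≡⇒≤-complement u+u'≡a h<u) b'u'≡h+1)
... | no h≮u = inj₂ ( solvable₁-of-small-residue (≮⇒≥ h≮u) bu≡h+1
                    , solvable₀-of-large-residue u'<a
                        (+-≡⇒≤-complement (trans (+-suc h h) (sym u+u'≡a)) (≮⇒≥ h≮u)) b'u'≡h+1)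
  where
    u'<a : u' < suc (h + h)
    u'<a = subst (u' <_) u+u'≡a (m<n+m u' (positive-residue {suc (h + h)} {suc β} {h} bu≡h+1))

complementary-solvability : ∀ {h β β'} → 1 ≤ h → Coprime (suc (h + h)) (suc β) →
  suc (h + h) ∣ suc β + suc β' →
  Solvable 0 (suc (h + h)) (suc β) (h * β) × Solvable 1 (suc (h + h)) (suc β') (h * β') ⊎
  Solvable 1 (suc (h + h)) (suc β) (h * β) × Solvable 0 (suc (h + h)) (suc β') (h * β')
complementary-solvability {h} {β} {β'} 1≤h a⊥b a∣b+b' =
  let u , u<a , bu≡h+1 = congruence-solvable h+1<a a⊥b
      u' , u+u'≡a = m≤n⇒∃[o]m+o≡n (<⇒≤ u<a)
  in complementary-residues {h} {β} {β'} u<a u+u'≡a bu≡h+1 (congruence-complement h+1<a a∣b+b' u+u'≡a bu≡h+1)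
  where
    h+1<a : suc h < suc (h + h)
    h+1<a = s≤s (m<m+n h 1≤h)

-- The function Γ

genus : ℕ → ℕ → ℕ
genus a b = ((a ∸ 1) * (b ∸ 1)) / 2

genus-odd : ∀ h β → genus (suc (h + h)) (suc β) ≡ h * β
genus-odd h β = trans (cong (_/ 2) (shuffle h β)) (m*n/n≡m (h * β) 2)
  where
    shuffle : ∀ h β → (h + h) * β ≡ h * β * 2
    shuffle = solve-∀

Γ≡0 : ∀ {a b} → let a' = a div gcd a b; b' = b div gcd a b in
  Solvable 0 a' b' (genus a' b') → Γ a b ≡ 0
Γ≡0 {a} {b} s with solvable? 0 (a div gcd a b) (b div gcd a b) (genus (a div gcd a b) (b div gcd a b))
... | yes _ = refl
... | no ¬s = ⊥-elim (¬s s)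

Γ≡1 : ∀ {a b} → let a' = a div gcd a b; b' = b div gcd a b in
  ¬ Solvable 0 a' b' (genus a' b') → Solvable 1 a' b' (genus a' b') → Γ a b ≡ 1
Γ≡1 {a} {b} ¬s₀ s₁
  with solvable? 0 (a div gcd a b) (b div gcd a b) (genus (a div gcd a b) (b div gcd a b))
     | solvable? 1 (a div gcd a b) (b div gcd a b) (genus (a div gcd a b) (b div gcd a b))
... | yes s₀ | _      = ⊥-elim (¬s₀ s₀)
... | no _   | yes _  = refl
... | no _   | no ¬s₁ = ⊥-elim (¬s₁ s₁)

solvable-genus-odd : ∀ {d a b h β} → a ≡ suc (h + h) → b ≡ suc β →
  Solvable d (suc (h + h)) (suc β) (h * β) ⇔ Solvable d a b (genus a b)
solvable-genus-odd {d} {h = h} {β} refl refl = mk⇔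
  (subst (Solvable d (suc (h + h)) (suc β)) (sym (genus-odd h β)))
  (subst (Solvable d (suc (h + h)) (suc β)) (genus-odd h β))


gcd-nonZero : ∀ m n .{{_ : NonZero m}} → NonZero (gcd m n)
gcd-nonZero m n = ≢-nonZero (gcd[m,n]≢0 m n (inj₁ (≢-nonZero⁻¹ m)))

div≡/ : ∀ m n .{{_ : NonZero n}} → m div n ≡ m / n
div≡/ m (suc n) = refl

module _ (m n : ℕ) .{{_ : NonZero m}} where

  private instance
    gcd≢0 : NonZero (gcd m n)
    gcd≢0 = gcd-nonZero m n

  div-gcd-cancelˡ : (m div gcd m n) * gcd m n ≡ m
  div-gcd-cancelˡ = trans (cong (_* gcd m n) (div≡/ m (gcd m n))) (m/n*n≡m (gcd[m,n]∣m m n))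

  div-gcd-cancelʳ : (n div gcd m n) * gcd m n ≡ n
  div-gcd-cancelʳ = trans (cong (_* gcd m n) (div≡/ n (gcd m n))) (m/n*n≡m (gcd[m,n]∣n m n))

  div-gcd-coprime : Coprime (m div gcd m n) (n div gcd m n)
  div-gcd-coprime = subst₂ Coprime (sym (div≡/ m (gcd m n))) (sym (div≡/ n (gcd m n))) (coprime-/gcd m n)

gcd-complement : ∀ {k b b'} → k ∣ b + b' → gcd k b' ≡ gcd k b
gcd-complement {k} {b} {b'} k∣b+b' = ∣-antisym
  (gcd-greatest (gcd[m,n]∣m k b') (∣-complement (gcd[m,n]∣m k b') (gcd[m,n]∣n k b') (subst (k ∣_) (+-comm b b') k∣b+b')))
  (gcd-greatest (gcd[m,n]∣m k b) (∣-complement (gcd[m,n]∣m k b) (gcd[m,n]∣n k b) k∣b+b'))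
  where
    ∣-complement : ∀ {d x y} → d ∣ k → d ∣ x → k ∣ x + y → d ∣ y
    ∣-complement d∣k d∣x k∣x+y = ∣m+n∣m⇒∣n (∣-trans d∣k k∣x+y) d∣x

odd-reduction : ∀ {k b b' g A B B'} .{{_ : NonZero g}} → ¬ 2 ∣ k → ¬ k ∣ b → k ∣ b + b' →
  A * g ≡ k → B * g ≡ b → B' * g ≡ b' →
  ∃ λ h → ∃ λ β → ∃ λ β' → 1 ≤ h × A ≡ suc (h + h) × B ≡ suc β × B' ≡ suc β' × suc (h + h) ∣ suc β + suc β'
odd-reduction {g = g} {A} {B} {B'} 2∤k k∤b k∣b+b' refl refl refl
  with odd⇒suc[h+h] {A} (2∤k ∘ ∣m⇒∣m*n g)
... | zero , refl = ⊥-elim (k∤b (*-monoˡ-∣ g (1∣ B)))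
... | suc h , refl with B | B'
...   | zero  | _      = ⊥-elim (k∤b (_ ∣0))
...   | suc β | zero   = ⊥-elim (k∤b (subst (suc (suc h + suc h) * g ∣_) (+-identityʳ (suc β * g)) k∣b+b'))
...   | suc β | suc β' = suc h , β , β' , s≤s z≤n , refl , refl , refl ,
        *-cancelʳ-∣ g (subst (suc (suc h + suc h) * g ∣_) (sym (*-distribʳ-+ g (suc β) (suc β'))) k∣b+b')

module _ {a b h β : ℕ} .{{_ : NonZero a}} (a≡ : a div gcd a b ≡ suc (h + h)) (b≡ : b div gcd a b ≡ suc β) where

  Γ≡0-of-reduced : Solvable 0 (suc (h + h)) (suc β) (h * β) → Γ a b ≡ 0
  Γ≡0-of-reduced = Γ≡0 ∘ Equivalence.to (solvable-genus-odd {h = h} {β} a≡ b≡)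

  Γ≡1-of-reduced : Solvable 1 (suc (h + h)) (suc β) (h * β) → Γ a b ≡ 1
  Γ≡1-of-reduced s₁ = Γ≡1
    (λ s₀ → ¬solvable₀×solvable₁ {h} {β} (subst₂ Coprime a≡ b≡ (div-gcd-coprime a b))
              (Equivalence.from (solvable-genus-odd {h = h} {β} a≡ b≡) s₀) s₁)
    (Equivalence.to (solvable-genus-odd {h = h} {β} a≡ b≡) s₁)

Γ-pair-of-reduced : ∀ {k b b' h β β'} .{{_ : NonZero k}} →
  k div gcd k b ≡ suc (h + h) → b div gcd k b ≡ suc β → k div gcd k b' ≡ suc (h + h) → b' div gcd k b' ≡ suc β' →
  1 ≤ h → suc (h + h) ∣ suc β + suc β' → Γ k b + Γ k b' ≡ 1
Γ-pair-of-reduced {k} {b} {b'} {h} {β} {β'} A≡ B≡ A'≡ B'≡ 1≤h a∣b+b' =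
  -- [_,_] rather than with: abstracting over Γ k b + Γ k b' would make Agda normalise Γ.
  [ (λ (s₀ , s₁') → cong₂ _+_ (Γ≡0-of-reduced {h = h} {β} A≡ B≡ s₀) (Γ≡1-of-reduced {h = h} {β'} A'≡ B'≡ s₁'))
  , (λ (s₁ , s₀') → cong₂ _+_ (Γ≡1-of-reduced {h = h} {β} A≡ B≡ s₁) (Γ≡0-of-reduced {h = h} {β'} A'≡ B'≡ s₀'))
  ] (complementary-solvability 1≤h (subst₂ Coprime A≡ B≡ (div-gcd-coprime k b)) a∣b+b')

Γ-pair : ∀ {k b b'} .{{_ : NonZero k}} → ¬ 2 ∣ k → ¬ k ∣ b → k ∣ b + b' → Γ k b + Γ k b' ≡ 1
Γ-pair {k} {b} {b'} 2∤k k∤b k∣b+b' =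
  let g'≡g = gcd-complement k∣b+b'
      h , β , β' , 1≤h , A≡ , B≡ , B'≡ , a∣b+b' = odd-reduction {g = gcd k b} {{gcd-nonZero k b}} 2∤k k∤b k∣b+b'
        (div-gcd-cancelˡ k b) (div-gcd-cancelʳ k b) (subst (λ g → (b' div g) * g ≡ b') g'≡g (div-gcd-cancelʳ k b'))
  in Γ-pair-of-reduced {h = h} A≡ B≡ (trans (cong (k div_) g'≡g) A≡) (trans (cong (b' div_) g'≡g) B'≡) 1≤h a∣b+b'

Γ-multiple : ∀ {k b} .{{_ : NonZero k}} → k ∣ b → Γ k b ≡ 0
Γ-multiple {k} {b} k∣b =
  Γ≡0 (subst (λ a → Solvable 0 a (b div gcd k b) (genus a (b div gcd k b))) (sym k/gcd≡1) (0 , 0 , *-zeroʳ (b div gcd k b)))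
  where
    k/gcd≡1 : k div gcd k b ≡ 1
    k/gcd≡1 = begin
      k div gcd k b ≡⟨ cong (k div_) (∣-antisym (gcd[m,n]∣m k b) (gcd-greatest ∣-refl k∣b)) ⟩
      k div k       ≡⟨ div≡/ k k ⟩
      k / k         ≡⟨ n/n≡1 k ⟩
      1             ∎
      where open ≡-Reasoning

∣b+[k∸1]*b : ∀ k b .{{_ : NonZero k}} → k ∣ b + (k ∸ 1) * b
∣b+[k∸1]*b (suc k') b = divides b (*-comm (suc k') b)

-- b and b + k are both complementary to (k − 1) b.
Γ-period : ∀ {k} b .{{_ : NonZero k}} → ¬ 2 ∣ k → Γ k (b + k) ≡ Γ k b
Γ-period {k} b 2∤k = by-cases (k ∣? b)
  where
    b* = (k ∸ 1) * b
    k∣b+k+b* : k ∣ b + k + b*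
    k∣b+k+b* = subst (k ∣_) (shuffle k b b*) (∣m∣n⇒∣m+n (∣-refl {k}) (∣b+[k∸1]*b k b))
      where
        shuffle : ∀ k b c → k + (b + c) ≡ b + k + c
        shuffle = solve-∀
    by-cases : Dec (k ∣ b) → Γ k (b + k) ≡ Γ k b
    by-cases (yes k∣b) = trans (Γ-multiple (∣m∣n⇒∣m+n k∣b ∣-refl)) (sym (Γ-multiple k∣b))
    by-cases (no k∤b) = +-cancelʳ-≡ (Γ k b*) _ _ (trans
      (Γ-pair 2∤k k∤b+k k∣b+k+b*)
      (sym (Γ-pair 2∤k k∤b (∣b+[k∸1]*b k b))))
      where
        k∤b+k : ¬ k ∣ b + k
        k∤b+k k∣b+k = k∤b (∣m+n∣m⇒∣n (subst (k ∣_) (+-comm b k) k∣b+k) ∣-refl)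

Γ-period-multiple : ∀ {k} b q .{{_ : NonZero k}} → ¬ 2 ∣ k → Γ k (b + q * k) ≡ Γ k b
Γ-period-multiple b zero 2∤k = cong (Γ _) (+-identityʳ b)
Γ-period-multiple {k} b (suc q) 2∤k = begin
  Γ k (b + (k + q * k)) ≡⟨ cong (Γ k) (shuffle b k (q * k)) ⟩
  Γ k (b + q * k + k)   ≡⟨ Γ-period (b + q * k) 2∤k ⟩
  Γ k (b + q * k)       ≡⟨ Γ-period-multiple b q 2∤k ⟩
  Γ k b                 ∎
  where
    open ≡-Reasoning
    shuffle : ∀ b k m → b + (k + m) ≡ b + m + k
    shuffle = solve-∀

-- Counting values in windows

indicator : ℕ → ℕ → ℕ
indicator v x = if x ≡ᵇ v then 1 else 0

indicator-complement : ∀ {v x y} → v ≤ 1 → x + y ≡ 1 → indicator v x + indicator v y ≡ 1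
indicator-complement {zero}        {zero}        _ refl = refl
indicator-complement {zero}        {suc zero}    _ refl = refl
indicator-complement {suc zero}    {zero}        _ refl = refl
indicator-complement {suc zero}    {suc zero}    _ refl = refl
indicator-complement {suc (suc _)} (s≤s ()) _
indicator-complement {x = suc (suc _)} _ ()

countIn-++ : ∀ f v n L₁ L₂ → countIn f v n (L₁ + L₂) ≡ countIn f v n L₁ + countIn f v (n + L₁) L₂
countIn-++ f v n zero L₂ = cong (λ m → countIn f v m L₂) (sym (+-identityʳ n))
countIn-++ f v n (suc L₁) L₂ = begin
  indicator v (f n) + countIn f v (suc n) (L₁ + L₂)
    ≡⟨ cong (indicator v (f n) +_) (countIn-++ f v (suc n) L₁ L₂) ⟩
  indicator v (f n) + (countIn f v (suc n) L₁ + countIn f v (suc n + L₁) L₂)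
    ≡⟨ +-assoc (indicator v (f n)) _ _ ⟨
  countIn f v n (suc L₁) + countIn f v (suc n + L₁) L₂
    ≡⟨ cong (λ m → countIn f v n (suc L₁) + countIn f v m L₂) (+-suc n L₁) ⟨
  countIn f v n (suc L₁) + countIn f v (n + suc L₁) L₂ ∎
  where open ≡-Reasoning

countIn-shift : ∀ {f N T} v → (∀ i → N ≤ i → f (i + T) ≡ f i) → ∀ {n} L → N ≤ n →
  countIn f v (n + T) L ≡ countIn f v n L
countIn-shift v per zero N≤n = refl
countIn-shift v per (suc L) N≤n =
  cong₂ (λ x y → indicator v x + y) (per _ N≤n) (countIn-shift v per L (m≤n⇒m≤1+n N≤n))

countIn-repeat : ∀ {f N T} v → (∀ i → N ≤ i → f (i + T) ≡ f i) → ∀ {n} q → N ≤ n →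
  countIn f v n (q * T) ≡ q * countIn f v n T
countIn-repeat v per zero N≤n = refl
countIn-repeat {f} {T = T} v per {n} (suc q) N≤n = begin
  countIn f v n (T + q * T)                      ≡⟨ countIn-++ f v n T (q * T) ⟩
  countIn f v n T + countIn f v (n + T) (q * T)  ≡⟨ cong (countIn f v n T +_) (countIn-repeat v per q (≤-trans N≤n (m≤m+n n T))) ⟩
  countIn f v n T + q * countIn f v (n + T) T    ≡⟨ cong (λ m → countIn f v n T + q * m) (countIn-shift v per T N≤n) ⟩
  countIn f v n T + q * countIn f v n T          ∎
  where open ≡-Reasoning

countIn-period-start : ∀ {f T} v → (∀ i → f (i + T) ≡ f i) → ∀ n → countIn f v n T ≡ countIn f v 0 T
countIn-period-start v per zero = refl
countIn-period-start {f} {T} v per (suc n) = trans (+-cancelˡ-≡ (indicator v (f n)) _ _ (begin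
    indicator v (f n) + countIn f v (suc n) T        ≡⟨ cong (countIn f v n) (+-comm 1 T) ⟩
    countIn f v n (T + 1)                            ≡⟨ countIn-++ f v n T 1 ⟩
    countIn f v n T + (indicator v (f (n + T)) + 0)  ≡⟨ cong (λ x → countIn f v n T + (indicator v x + 0)) (per n) ⟩
    countIn f v n T + (indicator v (f n) + 0)        ≡⟨ shuffle (countIn f v n T) (indicator v (f n)) ⟩
    indicator v (f n) + countIn f v n T              ∎))
  (countIn-period-start v per n)
  where
    open ≡-Reasoning
    shuffle : ∀ a b → a + (b + 0) ≡ b + a
    shuffle = solve-∀

countIn-paired : ∀ f v n E → v ≤ 1 → (∀ i j → suc (i + j) ≡ E + E → f (n + i) + f (n + j) ≡ 1) →
  countIn f v n (E + E) ≡ E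
countIn-paired f v n zero v≤1 pairs = refl
countIn-paired f v n (suc E) v≤1 pairs = begin
  countIn f v n (suc E + suc E)                                         ≡⟨ cong (countIn f v n) (shuffle₁ E) ⟩
  countIn f v n (suc (E + E) + 1)                                       ≡⟨ countIn-++ f v n (suc (E + E)) 1 ⟩
  indicator v (f n) + countIn f v (suc n) (E + E) + (indicator v (f last) + 0)
    ≡⟨ cong (λ m → indicator v (f n) + m + (indicator v (f last) + 0)) (countIn-paired f v (suc n) E v≤1 inner) ⟩
  indicator v (f n) + E + (indicator v (f last) + 0)                    ≡⟨ shuffle₂ (indicator v (f n)) (indicator v (f last)) E ⟩
  indicator v (f n) + indicator v (f last) + E                          ≡⟨ cong (_+ E) (indicator-complement {x = f n} {f last} v≤1 outer) ⟩
  suc E                                                                 ∎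
  where
    open ≡-Reasoning
    last = n + suc (E + E)
    shuffle₁ : ∀ E → suc E + suc E ≡ suc (E + E) + 1
    shuffle₁ = solve-∀
    shuffle₂ : ∀ a b E → a + E + (b + 0) ≡ a + b + E
    shuffle₂ = solve-∀
    outer : f n + f last ≡ 1
    outer = trans (cong (λ m → f m + f last) (sym (+-identityʳ n)))
                  (pairs 0 (suc (E + E)) (cong suc (sym (+-suc E E))))
    inner : ∀ i j → suc (i + j) ≡ E + E → f (suc n + i) + f (suc n + j) ≡ 1
    inner i j i+j+1≡E+E = trans (cong₂ (λ x y → f x + f y) (sym (+-suc n i)) (sym (+-suc n j)))
      (pairs (suc i) (suc j) (cong suc (trans (cong suc (+-suc i j)) (trans (cong suc i+j+1≡E+E) (sym (+-suc E E))))))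

-- Around a zero at n₀, the other 2K terms of a period pair up into complementary values.
countIn-centred-window : ∀ {s k K n₀} → k ≡ suc (K + K) → (∀ n → s (n + k) ≡ s n) → s n₀ ≡ 0 →
  (∀ i j → suc i + suc j ≡ k → s (suc n₀ + i) + s (suc n₀ + j) ≡ 1) →
  ∀ v → v ≤ 1 → ∀ n → countIn s v n k ≡ indicator v 0 + K
countIn-centred-window {s} {K = K} {n₀} refl per s[n₀]≡0 pairs v v≤1 n = begin
  countIn s v n (suc (K + K))                        ≡⟨ countIn-period-start v per n ⟩
  countIn s v 0 (suc (K + K))                        ≡⟨ countIn-period-start v per n₀ ⟨
  indicator v (s n₀) + countIn s v (suc n₀) (K + K)  ≡⟨ cong₂ (λ x y → indicator v x + y) s[n₀]≡0
                                                          (countIn-paired s v (suc n₀) K v≤1 pairs′) ⟩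
  indicator v 0 + K                                  ∎
  where
    open ≡-Reasoning
    pairs′ : ∀ i j → suc (i + j) ≡ K + K → s (suc n₀ + i) + s (suc n₀ + j) ≡ 1
    pairs′ i j i+j+1≡K+K = pairs i j (cong suc (trans (+-suc i j) i+j+1≡K+K))

-- Counting the zeros z and ones o among k T consecutive terms in two ways gives k (z − o) = T.
eventual-period-divisible : ∀ {s k} → (∀ n → s (n + k) ≡ s n) →
  (∀ n → countIn s 0 n k ≡ suc (countIn s 1 n k)) → ∀ T → EventuallyPeriodicWith s T → k ∣ T
eventual-period-divisible {s} {k} per surplus T (N , perT) =
  ∣m+n∣m⇒∣n (subst (k ∣_) k*z≡k*o+T (m∣m*n z)) (m∣m*n o)
  where
    open ≡-Reasoning
    scaled : ∀ v → k * countIn s v N T ≡ T * countIn s v N k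
    scaled v = begin
      k * countIn s v N T    ≡⟨ countIn-repeat v perT k ≤-refl ⟨
      countIn s v N (k * T)  ≡⟨ cong (countIn s v N) (*-comm k T) ⟩
      countIn s v N (T * k)  ≡⟨ countIn-repeat v (λ i _ → per i) T z≤n ⟩
      T * countIn s v N k    ∎
    z = countIn s 0 N T
    o = countIn s 1 N T
    k*z≡k*o+T : k * z ≡ k * o + T
    k*z≡k*o+T = begin
      k * z                      ≡⟨ scaled 0 ⟩
      T * countIn s 0 N k        ≡⟨ cong (T *_) (surplus N) ⟩
      T * suc (countIn s 1 N k)  ≡⟨ *-suc T _ ⟩
      T + T * countIn s 1 N k    ≡⟨ cong (T +_) (scaled 1) ⟨
      T + k * o                  ≡⟨ +-comm T (k * o) ⟩
      k * o + T                  ∎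

-- The sequence Γ(k, p n − r)

Γ-progression-pair : ∀ {k p c} .{{_ : NonZero k}} → ¬ 2 ∣ k → Coprime k p → k ∣ c →
  ∀ {i j} → suc i + suc j ≡ k → Γ k (c + p * suc i) + Γ k (c + p * suc j) ≡ 1
Γ-progression-pair {k} {p} {c} 2∤k k⊥p k∣c {i} {j} i+j+2≡k = Γ-pair 2∤k k∤c+p[i+1] k∣sum
  where
    k∤c+p[i+1] : ¬ k ∣ c + p * suc i
    k∤c+p[i+1] k∣c+p[i+1] = <⇒≱ (subst (suc i <_) i+j+2≡k (m<m+n (suc i) (s≤s z≤n)))
      (∣⇒≤ (coprime-divisor k⊥p (∣m+n∣m⇒∣n k∣c+p[i+1] k∣c)))
    shuffle : ∀ c p i j → c + c + p * (suc i + suc j) ≡ (c + p * suc i) + (c + p * suc j)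
    shuffle = solve-∀
    k∣sum : k ∣ (c + p * suc i) + (c + p * suc j)
    k∣sum = subst (k ∣_) (shuffle c p i j)
      (∣m∣n⇒∣m+n (∣m∣n⇒∣m+n k∣c k∣c) (subst (λ m → k ∣ p * m) (sym i+j+2≡k) (n∣m*n p)))

ΓSeq≡Γ : ∀ {k p r} → r < p → ∀ m → ΓSeq k p r m ≡ Γ k (p * m + (p ∸ r))
ΓSeq≡Γ {k} {p} {r} r<p m = cong (Γ k) (begin
  p * suc m ∸ r    ≡⟨ cong (_∸ r) (trans (*-suc p m) (+-comm p (p * m))) ⟩
  p * m + p ∸ r    ≡⟨ +-∸-assoc (p * m) (<⇒≤ r<p) ⟩
  p * m + (p ∸ r)  ∎)
  where open ≡-Reasoning

ΓSeq-period : ∀ {k p r} .{{_ : NonZero k}} → r < p → ¬ 2 ∣ k → ∀ n → ΓSeq k p r (n + k) ≡ ΓSeq k p r n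
ΓSeq-period {k} {p} {r} r<p 2∤k n = begin
  ΓSeq k p r (n + k)           ≡⟨ ΓSeq≡Γ r<p (n + k) ⟩
  Γ k (p * (n + k) + e)        ≡⟨ cong (Γ k) (shuffle p n k e) ⟩
  Γ k (p * n + e + p * k)      ≡⟨ Γ-period-multiple (p * n + e) p 2∤k ⟩
  Γ k (p * n + e)              ≡⟨ ΓSeq≡Γ r<p n ⟨
  ΓSeq k p r n                 ∎
  where
    open ≡-Reasoning
    e = p ∸ r
    shuffle : ∀ p n k e → p * (n + k) + e ≡ p * n + e + p * k
    shuffle = solve-∀

ΓSeq-pairs : ∀ {k p r n₀} .{{_ : NonZero k}} → r < p → ¬ 2 ∣ k → Coprime k p → k ∣ p * n₀ + (p ∸ r) →
  ∀ i j → suc i + suc j ≡ k → ΓSeq k p r (suc n₀ + i) + ΓSeq k p r (suc n₀ + j) ≡ 1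
ΓSeq-pairs {k} {p} {r} {n₀} r<p 2∤k k⊥p k∣pn₀+e i j i+j+2≡k =
  trans (cong₂ _+_ (ΓSeq[n₀+1+i]≡ i) (ΓSeq[n₀+1+i]≡ j)) (Γ-progression-pair 2∤k k⊥p k∣pn₀+e i+j+2≡k)
  where
    e = p ∸ r
    shuffle : ∀ p n i e → p * suc (n + i) + e ≡ p * n + e + p * suc i
    shuffle = solve-∀
    ΓSeq[n₀+1+i]≡ : ∀ i → ΓSeq k p r (suc n₀ + i) ≡ Γ k (p * n₀ + e + p * suc i)
    ΓSeq[n₀+1+i]≡ i = trans (ΓSeq≡Γ r<p (suc n₀ + i)) (cong (Γ k) (shuffle p n₀ i e))

ΓSeq-surplus : ∀ {k p r} .{{_ : NonZero k}} → r < p → ¬ 2 ∣ k → Coprime k p →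
  ∀ n → countIn (ΓSeq k p r) 0 n k ≡ suc (countIn (ΓSeq k p r) 1 n k)
ΓSeq-surplus {k} {p} {r} r<p 2∤k k⊥p n = surplus (odd⇒suc[h+h] 2∤k) (coprime⇒∃[n]∣b*n+e k⊥p (p ∸ r))
  where
    surplus : (∃ λ K → k ≡ suc (K + K)) → (∃ λ n₀ → k ∣ p * n₀ + (p ∸ r)) →
      countIn (ΓSeq k p r) 0 n k ≡ suc (countIn (ΓSeq k p r) 1 n k)
    surplus (K , k≡2K+1) (n₀ , k∣pn₀+e) = trans (count 0 z≤n n) (cong suc (sym (count 1 (s≤s z≤n) n)))
      where
        -- The implicit arguments are given: inferring them by unification would unfold Γ.
        count : ∀ v → v ≤ 1 → ∀ m → countIn (ΓSeq k p r) v m k ≡ indicator v 0 + K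
        count = countIn-centred-window {ΓSeq k p r} {k} {K} {n₀} k≡2K+1 (ΓSeq-period {k} {p} {r} r<p 2∤k)
          (trans (ΓSeq≡Γ {k} {p} {r} r<p n₀) (Γ-multiple {k} k∣pn₀+e)) (ΓSeq-pairs {k} {p} {r} {n₀} r<p 2∤k k⊥p k∣pn₀+e)

mainTheorem2 : (p r k : ℕ) → r < p → ¬ (2 ∣ k) → gcd k p ≡ 1 →
    IsEventualMinimalPeriod (ΓSeq k p r) k ×
    (∃ λ N → (∀ n → N ≤ n → ΓSeq k p r (n + k) ≡ ΓSeq k p r n) ×
             (∀ n → N ≤ n → countIn (ΓSeq k p r) 0 n k ≡ suc (countIn (ΓSeq k p r) 1 n k)))
mainTheorem2 p r k r<p 2∤k gcd≡1 =
  (>-nonZero⁻¹ k , (0 , λ n _ → period n) , minimal) , 0 , (λ n _ → period n) , λ n _ → surplus n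
  where
    instance
      k≢0 : NonZero k
      k≢0 = odd⇒nonZero 2∤k
    period : ∀ n → ΓSeq k p r (n + k) ≡ ΓSeq k p r n
    period = ΓSeq-period {k} {p} {r} r<p 2∤k
    surplus : ∀ n → countIn (ΓSeq k p r) 0 n k ≡ suc (countIn (ΓSeq k p r) 1 n k)
    surplus = ΓSeq-surplus {k} {p} {r} r<p 2∤k (gcd≡1⇒coprime gcd≡1)
    minimal : ∀ T → 0 < T → EventuallyPeriodicWith (ΓSeq k p r) T → k ≤ T
    minimal T 0<T perT = ∣⇒≤ {{>-nonZero 0<T}} (eventual-period-divisible {ΓSeq k p r} {k} period surplus T perT)
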